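{- Let $H$ be a Heyting algebra and let $f$ and $g$ be monotone polynomials on $H$ such that $\mu_{x}.f(x) = f^{m}(\bot)$ and $\mu_{x}.g(x) = g^{n}(\bot)$ for some $m,n\ge 0$. Then $\mu_{x}.(f\land g)(x) = (f\land g)^{m+n-1}(\bot)$, with the convention that $k^{j}(\bot)=\bot$ for $j<0$. That is, $\mathrm{cl}(f\land g)\le \mathrm{cl}(f)+\mathrm{cl}(g)-1$.
   Context: A function $f : H \to H$ on a Heyting algebra $H$ is a polynomial if there exist an IPC formula $\phi$, a variable $x$, and a valuation $v$ in $H$ of the variables of $\phi$ other than $x$ such that $f(h) = [\![\phi]\!]_{(v,h/x)}$ for all $h\in H$. $(f\land g)(x) = f(x)\land g(x)$. $\mu_x.k(x)$ is the least fixed point of $k$; the closure ordinal $\mathrm{cl}(k)$ is the least $n$ with $k^{n+1}(\bot)=k^n(\bot)$. -}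

module Defs where

open import Level using (Level)
open import Data.Nat using (ℕ; zero; suc; _≟_)
open import Data.Product using (Σ; ∃; _×_)
open import Relation.Nullary using (yes; no)
open import Relation.Binary.Lattice.Bundles using (HeytingAlgebra)

data Formula : Set where
  var  : ℕ → Formula
  ⊥f   : Formula
  ⊤f   : Formula
  _∧f_ : Formula → Formula → Formula
  _∨f_ : Formula → Formula → Formula
  _⇒f_ : Formula → Formula → Formula

module _ {c ℓ₁ ℓ₂ : Level} (H : HeytingAlgebra c ℓ₁ ℓ₂) where
  open HeytingAlgebra H

  ⟦_⟧ : Formula → (ℕ → Carrier) → Carrier
  ⟦ var i ⟧ v = v i
  ⟦ ⊥f ⟧ v = ⊥
  ⟦ ⊤f ⟧ v = ⊤
  ⟦ φ ∧f ψ ⟧ v = ⟦ φ ⟧ v ∧ ⟦ ψ ⟧ v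
  ⟦ φ ∨f ψ ⟧ v = ⟦ φ ⟧ v ∨ ⟦ ψ ⟧ v
  ⟦ φ ⇒f ψ ⟧ v = ⟦ φ ⟧ v ⇨ ⟦ ψ ⟧ v

  update : (ℕ → Carrier) → ℕ → Carrier → (ℕ → Carrier)
  update v x h i with i ≟ x
  ... | yes _ = h
  ... | no _  = v i

  IsPolynomial : (Carrier → Carrier) → Set (c Level.⊔ ℓ₁)
  IsPolynomial f = Σ Formula λ φ → Σ ℕ λ x → Σ (ℕ → Carrier) λ v →
                     ∀ h → f h ≈ ⟦ φ ⟧ (update v x h)

  Monotone : (Carrier → Carrier) → Set (c Level.⊔ ℓ₂)
  Monotone f = ∀ {a b} → a ≤ b → f a ≤ f b

  _∧ᶠ_ : (Carrier → Carrier) → (Carrier → Carrier) → (Carrier → Carrier)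
  (f ∧ᶠ g) h = f h ∧ g h

  iter : (Carrier → Carrier) → ℕ → Carrier → Carrier
  iter k zero a = a
  iter k (suc n) a = k (iter k n a)

  IsLeastFixedPoint : (Carrier → Carrier) → Carrier → Set (c Level.⊔ ℓ₁ Level.⊔ ℓ₂)
  IsLeastFixedPoint k a = (k a ≈ a) × (∀ b → k b ≈ b → a ≤ b)

-- Every polynomial f is strong: a ∧ f y ≤ f (a ∧ y), by induction on the formula, since y and
-- a ∧ y agree below a and the interpretation of a formula respects agreement below a.  Writing
-- Bᵢ = fⁱ(⊥), Cⱼ = gʲ(⊥) and Aₖ = (f ∧ g)ᵏ(⊥), strength gives
-- Bᵢ₊₁ ∧ Cⱼ₊₁ ≤ f (Bᵢ ∧ Cⱼ₊₁) ∧ g (Bᵢ₊₁ ∧ Cⱼ), so induction on i + j yields Bᵢ ∧ Cⱼ ≤ Aᵢ₊ⱼ₋₁.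
-- Finally Bₘ ∧ Cₙ is a prefixed point of f ∧ g lying below Aₘ₊ₙ₋₁, so the chain stops there.

module Submission where

open import Defs
open import Level using (Level)
open import Data.Nat using (ℕ; zero; suc; _+_; _∸_; _≟_; pred)
open import Data.Nat.Properties using (+-suc)
open import Data.Product using (_×_; _,_)
open import Relation.Nullary using (yes; no)
open import Relation.Binary.PropositionalEquality using (cong; subst; sym)
open import Relation.Binary.Lattice.Bundles using (HeytingAlgebra)
import Relation.Binary.Lattice.Properties.HeytingAlgebra as HeytingAlgebraProperties
import Relation.Binary.Lattice.Properties.MeetSemilattice as MeetSemilatticeProperties
import Relation.Binary.Reasoning.PartialOrder as ≤-Reasoning

module _ {c ℓ₁ ℓ₂ : Level} (H : HeytingAlgebra c ℓ₁ ℓ₂) where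
  open HeytingAlgebra H
  open HeytingAlgebraProperties H using (⇨-applyˡ; ∧-distribˡ-∨-≤)
  open MeetSemilatticeProperties meetSemilattice using (∧-comm; ∧-monotonic)
  open ≤-Reasoning poset

  -- Equivalently a ∧ y ≈ a ∧ z.
  AgreeBelow : Carrier → Carrier → Carrier → Set ℓ₂
  AgreeBelow a y z = (a ∧ y ≤ z) × (a ∧ z ≤ y)

  -- A tensorial strength for f, with ∧ as the tensor.
  IsStrong : (Carrier → Carrier) → Set (c Level.⊔ ℓ₂)
  IsStrong f = ∀ a y → a ∧ f y ≤ f (a ∧ y)

  agreeBelow-sym : ∀ {a y z} → AgreeBelow a y z → AgreeBelow a z y
  agreeBelow-sym (a∧y≤z , a∧z≤y) = a∧z≤y , a∧y≤z

  agreeBelow-∧ : ∀ a y → AgreeBelow a y (a ∧ y)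
  agreeBelow-∧ a y = refl , trans (x∧y≤y _ _) (x∧y≤y _ _)

  update-agreeBelow : ∀ {a y z} v x → AgreeBelow a y z →
                      ∀ i → AgreeBelow a (update H v x y i) (update H v x z i)
  update-agreeBelow v x agree i with i ≟ x
  ... | yes _ = agree
  ... | no _  = x∧y≤y _ _ , x∧y≤y _ _

  ⟦⟧-transfer : ∀ φ {a u w} → (∀ i → AgreeBelow a (u i) (w i)) → a ∧ ⟦ H ⟧ φ u ≤ ⟦ H ⟧ φ w
  ⟦⟧-transfer (var i) agree = let (a∧u≤w , _) = agree i in a∧u≤w
  ⟦⟧-transfer ⊥f agree = x∧y≤y _ _
  ⟦⟧-transfer ⊤f agree = maximum _
  ⟦⟧-transfer (φ ∧f ψ) agree =
    ∧-greatest (trans (∧-monotonic refl (x∧y≤x _ _)) (⟦⟧-transfer φ agree))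
               (trans (∧-monotonic refl (x∧y≤y _ _)) (⟦⟧-transfer ψ agree))
  ⟦⟧-transfer (φ ∨f ψ) agree =
    trans (∧-distribˡ-∨-≤ _ _ _)
          (∨-least (trans (⟦⟧-transfer φ agree) (x≤x∨y _ _))
                   (trans (⟦⟧-transfer ψ agree) (y≤x∨y _ _)))
  ⟦⟧-transfer (φ ⇒f ψ) {a} {u} {w} agree = transpose-⇨ (begin
    (a ∧ (⟦ H ⟧ φ u ⇨ ⟦ H ⟧ ψ u)) ∧ ⟦ H ⟧ φ w  ≤⟨ ∧-greatest (trans (x∧y≤x _ _) (x∧y≤x _ _)) modus-ponens ⟩
    a ∧ ⟦ H ⟧ ψ u                             ≤⟨ ⟦⟧-transfer ψ agree ⟩
    ⟦ H ⟧ ψ w                                 ∎)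
    where
    -- The antecedent occurs contravariantly, hence the symmetric agreement hypothesis.
    modus-ponens : (a ∧ (⟦ H ⟧ φ u ⇨ ⟦ H ⟧ ψ u)) ∧ ⟦ H ⟧ φ w ≤ ⟦ H ⟧ ψ u
    modus-ponens =
      trans (∧-greatest (trans (x∧y≤x _ _) (x∧y≤y _ _)) (∧-monotonic (x∧y≤x _ _) refl))
            (⇨-applyˡ (⟦⟧-transfer φ (λ i → agreeBelow-sym (agree i))))

  polynomial⇒strong : ∀ {f} → IsPolynomial H f → IsStrong f
  polynomial⇒strong {f} (φ , x , v , f≈⟦φ⟧) a y = begin
    a ∧ f y                         ≤⟨ ∧-monotonic refl (reflexive (f≈⟦φ⟧ y)) ⟩
    a ∧ ⟦ H ⟧ φ (update H v x y)     ≤⟨ ⟦⟧-transfer φ (update-agreeBelow v x (agreeBelow-∧ a y)) ⟩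
    ⟦ H ⟧ φ (update H v x (a ∧ y))   ≈⟨ Eq.sym (f≈⟦φ⟧ (a ∧ y)) ⟩
    f (a ∧ y)                       ∎

  ∧ᶠ-monotone : ∀ {f g} → Monotone H f → Monotone H g → Monotone H (_∧ᶠ_ H f g)
  ∧ᶠ-monotone f-mono g-mono a≤b = ∧-monotonic (f-mono a≤b) (g-mono a≤b)

  ∧ᶠ-prefixed : ∀ {f g a b} → Monotone H f → Monotone H g → f a ≤ a → g b ≤ b →
                _∧ᶠ_ H f g (a ∧ b) ≤ a ∧ b
  ∧ᶠ-prefixed f-mono g-mono fa≤a gb≤b =
    ∧-monotonic (trans (f-mono (x∧y≤x _ _)) fa≤a) (trans (g-mono (x∧y≤y _ _)) gb≤b)

  iter-⊥-increasing : ∀ {k} → Monotone H k → ∀ n → iter H k n ⊥ ≤ iter H k (suc n) ⊥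
  iter-⊥-increasing k-mono zero    = minimum _
  iter-⊥-increasing k-mono (suc n) = k-mono (iter-⊥-increasing k-mono n)

  iter-⊥-≤-prefixed : ∀ {k b} → Monotone H k → k b ≤ b → ∀ n → iter H k n ⊥ ≤ b
  iter-⊥-≤-prefixed k-mono kb≤b zero    = minimum _
  iter-⊥-≤-prefixed k-mono kb≤b (suc n) = trans (k-mono (iter-⊥-≤-prefixed k-mono kb≤b n)) kb≤b

  iter-⊥-isLeastFixedPoint : ∀ {k} → Monotone H k → ∀ n →
                             k (iter H k n ⊥) ≤ iter H k n ⊥ → IsLeastFixedPoint H k (iter H k n ⊥)
  iter-⊥-isLeastFixedPoint k-mono n stable =
    antisym stable (iter-⊥-increasing k-mono n) ,
    λ b kb≈b → iter-⊥-≤-prefixed k-mono (reflexive kb≈b) n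

  module _ {f g : Carrier → Carrier} (f-mono : Monotone H f) (g-mono : Monotone H g)
           (f-strong : IsStrong f) (g-strong : IsStrong g) where

    iter-∧-≤-iter-∧ᶠ : ∀ i j → iter H f i ⊥ ∧ iter H g j ⊥ ≤ iter H (_∧ᶠ_ H f g) ((i + j) ∸ 1) ⊥
    iter-∧-≤-iter-∧ᶠ zero    j       = trans (x∧y≤x _ _) (minimum _)
    iter-∧-≤-iter-∧ᶠ (suc i) zero    = trans (x∧y≤y _ _) (minimum _)
    iter-∧-≤-iter-∧ᶠ (suc i) (suc j) =
      subst (λ k → B (suc i) ∧ C (suc j) ≤ A k) (sym (+-suc i j)) (∧-greatest f-part g-part)
      where
      A B C : ℕ → Carrier
      A k = iter H (_∧ᶠ_ H f g) k ⊥
      B k = iter H f k ⊥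
      C k = iter H g k ⊥

      f-part : f (B i) ∧ C (suc j) ≤ f (A (i + j))
      f-part = begin
        f (B i) ∧ C (suc j)   ≈⟨ ∧-comm _ _ ⟩
        C (suc j) ∧ f (B i)   ≤⟨ f-strong _ _ ⟩
        f (C (suc j) ∧ B i)   ≤⟨ f-mono (trans (reflexive (∧-comm _ _)) previous) ⟩
        f (A (i + j))         ∎
        where
        previous : B i ∧ C (suc j) ≤ A (i + j)
        previous = subst (λ k → B i ∧ C (suc j) ≤ A k) (cong pred (+-suc i j)) (iter-∧-≤-iter-∧ᶠ i (suc j))

      g-part : B (suc i) ∧ g (C j) ≤ g (A (i + j))
      g-part = begin
        B (suc i) ∧ g (C j)   ≤⟨ g-strong _ _ ⟩
        g (B (suc i) ∧ C j)   ≤⟨ g-mono (iter-∧-≤-iter-∧ᶠ (suc i) j) ⟩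
        g (A (i + j))         ∎

proposition6p10 : {c ℓ₁ ℓ₂ : Level} (H : HeytingAlgebra c ℓ₁ ℓ₂) →
    let open HeytingAlgebra H in
    (f g : Carrier → Carrier) (m n : ℕ) →
    IsPolynomial H f → IsPolynomial H g →
    Monotone H f → Monotone H g →
    IsLeastFixedPoint H f (iter H f m ⊥) →
    IsLeastFixedPoint H g (iter H g n ⊥) →
    IsLeastFixedPoint H (_∧ᶠ_ H f g) (iter H (_∧ᶠ_ H f g) ((m + n) ∸ 1) ⊥)
proposition6p10 H f g m n f-poly g-poly f-mono g-mono (f-fixed , _) (g-fixed , _) =
  iter-⊥-isLeastFixedPoint H h-mono (m + n ∸ 1) (begin
    h (A (m + n ∸ 1))  ≤⟨ h-mono (iter-⊥-≤-prefixed H h-mono M-prefixed (m + n ∸ 1)) ⟩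
    h M                ≤⟨ M-prefixed ⟩
    M                  ≤⟨ iter-∧-≤-iter-∧ᶠ H f-mono g-mono (polynomial⇒strong H f-poly)
                                                        (polynomial⇒strong H g-poly) m n ⟩
    A (m + n ∸ 1)      ∎)
  where
  open HeytingAlgebra H
  open ≤-Reasoning poset

  h : Carrier → Carrier
  h = _∧ᶠ_ H f g

  A : ℕ → Carrier
  A k = iter H h k ⊥

  h-mono : Monotone H h
  h-mono = ∧ᶠ-monotone H f-mono g-mono

  M : Carrier
  M = iter H f m ⊥ ∧ iter H g n ⊥

  M-prefixed : h M ≤ M
  M-prefixed = ∧ᶠ-prefixed H f-mono g-mono (reflexive f-fixed) (reflexive g-fixed)
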